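{- Let $p$ be a positive integer, $H$ a graph, $T$ a complete rooted ternary tree and $V\subseteq V(T(H))$. Let $T_1,\dots,T_q$ be a minimal sequence of largest subtrees of $T$ with respect to $V$ lacking $p$, and let $V_1,\dots,V_q$ be the corresponding sequence of sets. Then $|OC(T_q,V_q)|\ge (|OC(T_1,V_1)|-p)/3$.
   Context: $T(H)$: disjoint copies $H^w$ ($w\in V(T)$) of $H$ with $w^i$ the copy of vertex $i$, plus edges $\{w^i,z^i\}$ for each vertex $i$ of $H$ and each edge $\{w,z\}$ of $T$; for a subtree $T'$ of $T$, $T'(H)$ is the subgraph formed by the copies over $V(T')$. For a subtree $T'$ and $V'\subseteq V(T(H))$, $OC(T',V')$ is the set of $w\in V(T')$ with $V(H^w)\cap V'\ne\emptyset$. A complete rooted ternary tree is a rooted tree in which every non-leaf vertex has 3 children and all root-leaf paths have the same length. An immediate subtree of $T$ is the subtree consisting of a child of the root and all its descendants; it is a largest immediate subtree w.r.t. $V$ if $|OC(T,V)\cap V(T')|$ is maximum among the immediate subtrees $T'$. A sequence of largest subtrees of $T$ w.r.t. $V$ is $T_1,\dots,T_q$ with $T_1=T$, $T_{i+1}$ a largest immediate subtree of $T_i$ w.r.t. $V_i$, with corresponding sets $V_1=V$, $V_{i+1}=V_i\cap V(T_{i+1}(H))$. It is a minimal sequence of largest subtrees lacking $p$ if $|OC(T_1,V_1)|-|OC(T_q,V_q)|\ge p$ while $|OC(T_1,V_1)|-|OC(T_{q-1},V_{q-1})|<p$. -}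

module Defs where

open import Data.Nat using (ℕ; zero; suc; _∸_; _≤_; _<_; _≤?_)
open import Data.Bool using (Bool; true; false; _∧_; _∨_)
open import Data.Fin using (Fin)
open import Data.Fin.Properties using () renaming (_≟_ to _≟ᶠ_)
open import Data.List using (List; []; _∷_; _++_; _∷ʳ_; map; concatMap; allFin; length; filterᵇ)
open import Data.Bool.ListAction using (or)
open import Relation.Nullary.Decidable using (⌊_⌋)
open import Relation.Binary.Construct.Closure.ReflexiveTransitive using (Star)
open import Data.Empty using (⊥)
open import Data.Product using (_×_; _,_)

-- A (finite) graph H on vertex set Fin n.  Only its vertex set matters
-- for the statement, but we keep the full structure.
record Graph : Set₁ where
  field
    n   : ℕ
    Adj : Fin n → Fin n → Set
    sym : ∀ {i j} → Adj i j → Adj j i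
    irr : ∀ {i} → Adj i i → ⊥

-- The complete rooted ternary tree T of depth d: its vertices are the
-- words over Fin 3 of length ≤ d; the root is [], and the children of
-- w are w ∷ʳ c for c : Fin 3 (when length w < d).
Node : Set
Node = List (Fin 3)

words : ℕ → List Node
words zero    = [] ∷ []
words (suc k) = [] ∷ concatMap (λ c → map (c ∷_) (words k)) (allFin 3)

-- vertex set of the subtree T_u of the depth-d tree rooted at u
-- (u together with all its descendants)
subtreeNodes : ℕ → Node → List Node
subtreeNodes d u = map (u ++_) (words (d ∸ length u))

prefixᵇ : Node → Node → Bool
prefixᵇ []      _        = true
prefixᵇ (_ ∷ _) []       = false
prefixᵇ (a ∷ u) (b ∷ w)  = ⌊ a ≟ᶠ b ⌋ ∧ prefixᵇ u w

-- (decidable) subsets of the vertex set of T(H): vertex (w , i) is w^i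
VSet : ℕ → Set
VSet n = Node → Fin n → Bool

_∩_ : ∀ {n} → VSet n → VSet n → VSet n
(A ∩ B) w i = A w i ∧ B w i

-- V(T_u(H)) : the vertices of the copies H^w for w in the subtree T_u
inSub : ∀ {n} → ℕ → Node → VSet n
inSub d u w i = prefixᵇ u w ∧ ⌊ length w ≤? d ⌋

-- |OC(T_u , W)| : number of w ∈ V(T_u) with V(H^w) ∩ W ≠ ∅
oc : ∀ {n} → ℕ → Node → VSet n → ℕ
oc {n} d u W = length (filterᵇ (λ w → or (map (W w) (allFin n))) (subtreeNodes d u))

-- One step of a sequence of largest subtrees:
-- (T_i , V_i) ↦ (T_{i+1} , V_{i+1}) where T_{i+1} (rooted at u ∷ʳ c) is a
-- largest immediate subtree of T_i (rooted at u) w.r.t. V_i and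
-- V_{i+1} = V_i ∩ V(T_{i+1}(H)).
data LargestStep {n : ℕ} (d : ℕ) : (Node × VSet n) → (Node × VSet n) → Set where
  step : ∀ {u W} (c : Fin 3) →
         length u < d →
         (∀ c' → oc d (u ∷ʳ c') W ≤ oc d (u ∷ʳ c) W) →
         LargestStep d (u , W) (u ∷ʳ c , W ∩ inSub d (u ∷ʳ c))

-- A sequence of largest subtrees (possibly of length 1) from one
-- (subtree, set) pair to another.
LargestSeq : ∀ {n} → ℕ → (Node × VSet n) → (Node × VSet n) → Set
LargestSeq d = Star (LargestStep d)

-- Only the last step (T_{q-1}, V_{q-1}) ↦ (T_q, V_q) of the sequence matters.
--  * Branching: the nodes of a non-leaf subtree T_u are u itself together
--    with the nodes of its three immediate subtrees, so
--    |OC(T_u,W)| ≤ 1 + Σ_c |OC(T_{uc},W)|.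
--  * Restriction: intersecting W with V(T_u(H)) does not change the set of
--    occupied nodes of T_u, so |OC(T_u, W ∩ V(T_u(H)))| = |OC(T_u,W)|.
--  * Hence a largest step satisfies |OC(T_{q-1},V_{q-1})| ≤ 1 + 3|OC(T_q,V_q)|.
-- Minimality gives |OC(T₁,V₁)| < p + |OC(T_{q-1},V_{q-1})|, and the theorem
-- follows by arithmetic.
module Submission where

open import Defs
open import Data.Nat using (ℕ; zero; suc; _+_; _*_; _≤_; _<_; _≤?_; _∸_; z≤n; s≤s)
open import Data.Nat.Properties
  using (≤-trans; ≤-refl; n≤1+n; +-comm; +-mono-≤; +-monoʳ-≤; +-suc; +-∸-assoc; m+[n∸m]≡n; ≤-pred; ≤-reflexive; module ≤-Reasoning)
open import Data.Fin using (Fin; zero; suc)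
open import Data.Fin.Properties using () renaming (_≟_ to _≟ᶠ_)
open import Data.List using (List; []; _∷_; _++_; _∷ʳ_; map; concat; concatMap; tabulate; length; filterᵇ; allFin)
open import Data.List.Properties using (length-++; map-∘; map-cong; ++-assoc; map-concatMap; concatMap-cong)
open import Data.List.Relation.Unary.All as All using (All; []; _∷_)
open import Data.List.Relation.Unary.All.Properties using (map⁺; concat⁺; tabulate⁺)
open import Data.Bool using (Bool; true; false; _∧_)
open import Data.Bool.Properties using (∧-identityʳ)
open import Data.Bool.ListAction using (or)
open import Data.Nat.ListAction using (sum)
open import Data.Product using (_,_)
open import Relation.Nullary using (Dec)
open import Relation.Nullary.Decidable using (⌊_⌋; dec-true; isYes≗does)
open import Relation.Binary.PropositionalEquality
  using (_≡_; refl; sym; trans; cong; cong₂; subst; module ≡-Reasoning)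

count : {A : Set} → (A → Bool) → List A → ℕ
count P xs = length (filterᵇ P xs)

count-∷ : {A : Set} (P : A → Bool) (x : A) (xs : List A) →
  count P (x ∷ xs) ≤ suc (count P xs)
count-∷ P x xs with P x
... | true  = ≤-refl
... | false = n≤1+n _

count-++ : {A : Set} (P : A → Bool) (xs ys : List A) →
  count P (xs ++ ys) ≡ count P xs + count P ys
count-++ P []       ys = refl
count-++ P (x ∷ xs) ys with P x
... | true  = cong suc (count-++ P xs ys)
... | false = count-++ P xs ys

count-cong : {A : Set} (P Q : A → Bool) (xs : List A) →
  All (λ x → P x ≡ Q x) xs → count P xs ≡ count Q xs
count-cong P Q []       []       = refl
count-cong P Q (x ∷ xs) (e ∷ es) with P x | Q x | count-cong P Q xs es
... | true  | true  | ih = cong suc ih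
... | false | false | ih = ih
count-cong P Q (x ∷ xs) (() ∷ es) | true  | false | _
count-cong P Q (x ∷ xs) (() ∷ es) | false | true  | _

⌊⌋-true : {A : Set} (a? : Dec A) → A → ⌊ a? ⌋ ≡ true
⌊⌋-true a? a = trans (isYes≗does a?) (dec-true a? a)

count-concat : {A : Set} (P : A → Bool) (xss : List (List A)) →
  count P (concat xss) ≡ sum (map (count P) xss)
count-concat P []         = refl
count-concat P (xs ∷ xss) =
  trans (count-++ P xs (concat xss)) (cong (count P xs +_) (count-concat P xss))

sum-tabulate-≤ : ∀ {k} (f : Fin k → ℕ) {m : ℕ} → (∀ i → f i ≤ m) → sum (tabulate f) ≤ k * m
sum-tabulate-≤ {zero}  f bounded = z≤n
sum-tabulate-≤ {suc k} f bounded =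
  +-mono-≤ (bounded zero) (sum-tabulate-≤ (λ i → f (suc i)) (λ i → bounded (suc i)))

length-∷ʳ : (u : Node) (c : Fin 3) → length (u ∷ʳ c) ≡ suc (length u)
length-∷ʳ u c = trans (length-++ u) (+-comm (length u) 1)

words-length : ∀ k → All (λ w → length w ≤ k) (words k)
words-length zero    = z≤n ∷ []
words-length (suc k) =
  z≤n ∷ concat⁺ (map⁺ {f = branch} (tabulate⁺ {f = λ c → c} λ c → map⁺ (All.map s≤s (words-length k))))
  where
  branch : Fin 3 → List Node
  branch c = map (c ∷_) (words k)

prefix-++ : (u v : Node) → prefixᵇ u (u ++ v) ≡ true
prefix-++ []      v = refl
prefix-++ (a ∷ u) v = cong₂ _∧_ (⌊⌋-true (a ≟ᶠ a) refl) (prefix-++ u v)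

child-nodes : (d : ℕ) (u : Node) (c : Fin 3) →
  map (u ++_) (map (c ∷_) (words (d ∸ suc (length u)))) ≡ subtreeNodes d (u ∷ʳ c)
child-nodes d u c rewrite length-∷ʳ u c =
  trans (sym (map-∘ ws)) (map-cong (λ w → sym (++-assoc u (c ∷ []) w)) ws)
  where ws = words (d ∸ suc (length u))

subtree-branches : (d : ℕ) (u : Node) → length u < d →
  subtreeNodes d u ≡ (u ++ []) ∷ concatMap (λ c → subtreeNodes d (u ∷ʳ c)) (allFin 3)
subtree-branches d u lt = begin
  map (u ++_) (words (d ∸ length u))
    ≡⟨ cong (λ m → map (u ++_) (words m)) (+-∸-assoc 1 lt) ⟩
  (u ++ []) ∷ map (u ++_) (concatMap (λ c → map (c ∷_) ws) (allFin 3))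
    ≡⟨ cong ((u ++ []) ∷_) (map-concatMap (u ++_) (λ c → map (c ∷_) ws) (allFin 3)) ⟩
  (u ++ []) ∷ concatMap (λ c → map (u ++_) (map (c ∷_) ws)) (allFin 3)
    ≡⟨ cong ((u ++ []) ∷_) (concatMap-cong (child-nodes d u) (allFin 3)) ⟩
  (u ++ []) ∷ concatMap (λ c → subtreeNodes d (u ∷ʳ c)) (allFin 3) ∎
  where
  open ≡-Reasoning
  ws = words (d ∸ suc (length u))

subtree-inSub : ∀ {n} (d : ℕ) (u : Node) → length u ≤ d →
  All (λ w → ∀ (i : Fin n) → inSub d u w i ≡ true) (subtreeNodes d u)
subtree-inSub d u le = map⁺ (All.map inside (words-length (d ∸ length u)))
  where
  inside : ∀ {x} → length x ≤ d ∸ length u → ∀ i → inSub d u (u ++ x) i ≡ true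
  inside {x} lx i = cong₂ _∧_ (prefix-++ u x) (⌊⌋-true (_ ≤? d) (begin
    length (u ++ x)      ≡⟨ length-++ u ⟩
    length u + length x  ≤⟨ +-monoʳ-≤ (length u) lx ⟩
    length u + (d ∸ length u) ≡⟨ m+[n∸m]≡n le ⟩
    d                    ∎))
    where open ≤-Reasoning

occupied : ∀ {n} → VSet n → Node → Bool
occupied {n} W w = or (map (W w) (allFin n))

oc-branches : ∀ {n} (d : ℕ) (u : Node) (W : VSet n) → length u < d →
  oc d u W ≤ suc (sum (map (λ c → oc d (u ∷ʳ c) W) (allFin 3)))
oc-branches d u W lt = begin
  oc d u W                                     ≡⟨ cong (count P) (subtree-branches d u lt) ⟩
  count P ((u ++ []) ∷ concat (map S (allFin 3))) ≤⟨ count-∷ P (u ++ []) _ ⟩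
  suc (count P (concat (map S (allFin 3))))    ≡⟨ cong suc (count-concat P (map S (allFin 3))) ⟩
  suc (sum (map (count P) (map S (allFin 3)))) ∎
  where
  open ≤-Reasoning
  P = occupied W
  S : Fin 3 → List Node
  S c = subtreeNodes d (u ∷ʳ c)

oc-restrict : ∀ {n} (d : ℕ) (u : Node) (W : VSet n) → length u ≤ d →
  oc d u (W ∩ inSub d u) ≡ oc d u W
oc-restrict {n} d u W le =
  count-cong (occupied (W ∩ inSub d u)) (occupied W) (subtreeNodes d u)
    (All.map same-occupancy (subtree-inSub d u le))
  where
  same-occupancy : ∀ {w} → (∀ i → inSub d u w i ≡ true) →
    occupied (W ∩ inSub d u) w ≡ occupied W w
  same-occupancy {w} inside = cong or (map-cong
    (λ i → trans (cong (W w i ∧_) (inside i)) (∧-identityʳ (W w i))) (allFin n))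

largest-step-bound : ∀ {n} {d : ℕ} {u u' : Node} {W W' : VSet n} →
  LargestStep d (u , W) (u' , W') → oc d u W ≤ suc (3 * oc d u' W')
largest-step-bound {d = d} {u} {W = W} (step c lt largest) =
  ≤-trans (oc-branches d u W lt)
    (s≤s (sum-tabulate-≤ (λ c' → oc d (u ∷ʳ c') W) bound))
  where
  child-inside : length (u ∷ʳ c) ≤ d
  child-inside = subst (_≤ d) (sym (length-∷ʳ u c)) lt
  bound : ∀ c' → oc d (u ∷ʳ c') W ≤ oc d (u ∷ʳ c) (W ∩ inSub d (u ∷ʳ c))
  bound c' = ≤-trans (largest c') (≤-reflexive (sym (oc-restrict d (u ∷ʳ c) W child-inside)))

lemma5 : (p : ℕ) → 1 ≤ p → (H : Graph) → (d : ℕ) →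
    (V : VSet (Graph.n H)) →
    (∀ w i → V w i ≡ true → length w ≤ d) →
    ∀ uq₋₁ Vq₋₁ uq Vq →
    LargestSeq d ([] , V) (uq₋₁ , Vq₋₁) →
    LargestStep d (uq₋₁ , Vq₋₁) (uq , Vq) →
    oc d [] V < p + oc d uq₋₁ Vq₋₁ →
    p + oc d uq Vq ≤ oc d [] V →
    oc d [] V ≤ p + 3 * oc d uq Vq
lemma5 p _ H d V _ uq₋₁ Vq₋₁ uq Vq _ last-step not-yet-lacking _ = ≤-pred (begin-strict
  oc d [] V                      <⟨ not-yet-lacking ⟩
  p + oc d uq₋₁ Vq₋₁             ≤⟨ +-monoʳ-≤ p (largest-step-bound last-step) ⟩
  p + suc (3 * oc d uq Vq)       ≡⟨ +-suc p _ ⟩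
  suc (p + 3 * oc d uq Vq)       ∎)
  where open ≤-Reasoning
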